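{- Let $n\ge1$ and define $\Xi^{(n)}_{m,j}=\frac{1}{2^n}\sum_{k=0}^n(n-2k)^mK^{(n)}_{k,j}$ for integers $m\ge0$ and $0\le j\le n$. If $m+j$ is odd, then $\Xi^{(n)}_{m,j}=0$.
   Context: Krawtchouk entries: $K^{(n)}_{r,j}=\sum_{l=0}^n(-1)^l\binom{n-j}{r-l}\binom{j}{l}$ for $0\le r,j\le n$, with $\binom{a}{b}=0$ if $b>a$ or $b<0$; $0^0=1$. -}

module Defs where

open import Data.Nat as ℕ using (ℕ; zero; suc; _≤ᵇ_; _∸_)
open import Data.Nat.Combinatorics using (_C_)
open import Data.Integer as ℤ using (ℤ; +_; -_)
open import Data.Rational as ℚ using (ℚ)
open import Data.Nat.Properties using (m^n≢0)
open import Data.Bool using (if_then_else_)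

sumℤ : ℕ → (ℕ → ℤ) → ℤ
sumℤ zero    f = f 0
sumℤ (suc n) f = sumℤ n f ℤ.+ f (suc n)

-- binomial (a choose b) for b an integer given as r - l with r,l natural;
-- equals 0 when b < 0 (i.e. l > r) and when b > a (handled by _C_).
binom⁻ : ℕ → ℕ → ℕ → ℤ
binom⁻ a r l = if l ≤ᵇ r then + (a C (r ∸ l)) else + 0

sgn : ℕ → ℤ
sgn zero    = + 1
sgn (suc l) = - sgn l

K : ℕ → ℕ → ℕ → ℤ
K n r j = sumℤ n (λ l → sgn l ℤ.* binom⁻ (n ∸ j) r l ℤ.* + (j C l))

-- Ξ^{(n)}_{m,j} = 2^{-n} Σ_{k=0}^n (n-2k)^m K^{(n)}_{k,j}   (with 0^0 = 1)
Ξ : ℕ → ℕ → ℕ → ℚ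
Ξ n m j = (sumℤ n (λ k → ((+ n) ℤ.- (+ (2 ℕ.* k))) ℤ.^ m ℤ.* K n k j))
          ℚ./ (2 ℕ.^ n)
  where instance _ = m^n≢0 2 n

-- The reflection k ↦ n − k flips the sign of the weight n − 2k, and it multiplies the
-- Krawtchouk entry by (−1)^j: reversing l ↦ j − l in the defining sum and using
-- C(a, d) = C(a, a − d) with a = n − j gives K_{n−k,j} = (−1)^j K_{k,j}. So the k-th and
-- (n−k)-th summands of the numerator of Ξ differ by the factor (−1)^(m+j) = −1, and the
-- sum equals its own negative.
module Submission where

open import Defs
open import Data.Nat using (ℕ; suc; _≤_; _+_; _*_)
open import Data.Product using (∃)
open import Data.Rational using (0ℚ)
open import Relation.Binary.PropositionalEquality using (_≡_)

open import Data.Nat using (zero; _∸_; _^_; _<_; _≤ᵇ_; _≤?_; z≤n; s≤s)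
import Data.Nat.Properties as ℕ
open import Data.Nat.Combinatorics using (_C_; nCk≡nC[n∸k]; k>n⇒nCk≡0)
open import Data.Integer as ℤ using (ℤ; +_; -[1+_]; -_; -1ℤ)
import Data.Integer.Properties as ℤ
open import Data.Integer.Tactic.RingSolver using (solve-∀)
import Data.Rational as ℚ
import Data.Rational.Properties as ℚ
open import Data.Product using (_,_)
open import Data.Sum using (inj₁; inj₂)
open import Data.Bool using (true; false; T)
open import Data.Unit using (tt)
open import Data.Empty using (⊥-elim)
open import Function using (_∘_)
open import Relation.Nullary using (yes; no)
open import Relation.Binary.PropositionalEquality
  using (refl; sym; trans; cong; cong₂; subst; module ≡-Reasoning)

open ≡-Reasoning

sumℤ-cong : ∀ n {f g : ℕ → ℤ} → (∀ k → k ≤ n → f k ≡ g k) → sumℤ n f ≡ sumℤ n g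
sumℤ-cong zero    f≗g = f≗g 0 z≤n
sumℤ-cong (suc n) f≗g =
  cong₂ ℤ._+_ (sumℤ-cong n (λ k k≤n → f≗g k (ℕ.m≤n⇒m≤1+n k≤n))) (f≗g (suc n) ℕ.≤-refl)

sumℤ-suc : ∀ n f → sumℤ (suc n) f ≡ f 0 ℤ.+ sumℤ n (f ∘ suc)
sumℤ-suc zero    f = refl
sumℤ-suc (suc n) f = begin
  sumℤ (suc n) f ℤ.+ f (suc (suc n))
    ≡⟨ cong (ℤ._+ f (suc (suc n))) (sumℤ-suc n f) ⟩
  f 0 ℤ.+ sumℤ n (f ∘ suc) ℤ.+ f (suc (suc n))
    ≡⟨ ℤ.+-assoc (f 0) _ _ ⟩
  f 0 ℤ.+ sumℤ (suc n) (f ∘ suc) ∎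

sumℤ-reverse : ∀ n f → sumℤ n f ≡ sumℤ n (λ k → f (n ∸ k))
sumℤ-reverse zero    f = refl
sumℤ-reverse (suc n) f = begin
  sumℤ n f ℤ.+ f (suc n)
    ≡⟨ cong (ℤ._+ f (suc n)) (sumℤ-reverse n f) ⟩
  sumℤ n (λ k → f (n ∸ k)) ℤ.+ f (suc n)
    ≡⟨ ℤ.+-comm _ (f (suc n)) ⟩
  f (suc n) ℤ.+ sumℤ n (λ k → f (n ∸ k))
    ≡⟨ sumℤ-suc n (λ k → f (suc n ∸ k)) ⟨
  sumℤ (suc n) (λ k → f (suc n ∸ k)) ∎

sumℤ-neg : ∀ n f → sumℤ n (λ k → - f k) ≡ - sumℤ n f
sumℤ-neg zero    f = refl
sumℤ-neg (suc n) f =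
  trans (cong (ℤ._+ - f (suc n)) (sumℤ-neg n f)) (sym (ℤ.neg-distrib-+ (sumℤ n f) (f (suc n))))

sumℤ-*ˡ : ∀ n c f → sumℤ n (λ k → c ℤ.* f k) ≡ c ℤ.* sumℤ n f
sumℤ-*ˡ zero    c f = refl
sumℤ-*ˡ (suc n) c f =
  trans (cong (ℤ._+ c ℤ.* f (suc n)) (sumℤ-*ˡ n c f)) (sym (ℤ.*-distribˡ-+ c (sumℤ n f) (f (suc n))))

sumℤ-truncate : ∀ n j f → j ≤ n → (∀ l → j < l → f l ≡ + 0) → sumℤ n f ≡ sumℤ j f
sumℤ-truncate zero    .zero f z≤n f≡0 = refl
sumℤ-truncate (suc n) j     f j≤1+n f≡0 with ℕ.m≤n⇒m<n∨m≡n j≤1+n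
... | inj₂ refl         = refl
... | inj₁ (s≤s j≤n) = begin
  sumℤ n f ℤ.+ f (suc n)   ≡⟨ cong₂ ℤ._+_ (sumℤ-truncate n j f j≤n f≡0) (f≡0 (suc n) (s≤s j≤n)) ⟩
  sumℤ j f ℤ.+ + 0         ≡⟨ ℤ.+-identityʳ (sumℤ j f) ⟩
  sumℤ j f                 ∎

x≡-x⇒x≡0 : ∀ x → x ≡ - x → x ≡ + 0
x≡-x⇒x≡0 (+ zero)  _  = refl
x≡-x⇒x≡0 (+ suc _) ()
x≡-x⇒x≡0 -[1+ _ ]  ()

sumℤ-antisymmetric : ∀ n f → (∀ k → k ≤ n → f (n ∸ k) ≡ - f k) → sumℤ n f ≡ + 0
sumℤ-antisymmetric n f f-antisym = x≡-x⇒x≡0 (sumℤ n f) (begin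
  sumℤ n f                   ≡⟨ sumℤ-reverse n f ⟩
  sumℤ n (λ k → f (n ∸ k))   ≡⟨ sumℤ-cong n f-antisym ⟩
  sumℤ n (λ k → - f k)       ≡⟨ sumℤ-neg n f ⟩
  - sumℤ n f                 ∎)

sgn-+ : ∀ p q → sgn (p + q) ≡ sgn p ℤ.* sgn q
sgn-+ zero    q = sym (ℤ.*-identityˡ (sgn q))
sgn-+ (suc p) q = trans (cong -_ (sgn-+ p q)) (ℤ.neg-distribˡ-* (sgn p) (sgn q))

sgn*sgn≡1 : ∀ l → sgn l ℤ.* sgn l ≡ + 1
sgn*sgn≡1 zero    = refl
sgn*sgn≡1 (suc l) = trans (-x*-x≡x*x (sgn l)) (sgn*sgn≡1 l)
  where
  -x*-x≡x*x : ∀ x → (- x) ℤ.* (- x) ≡ x ℤ.* x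
  -x*-x≡x*x = solve-∀

sgn-∸ : ∀ {j l} → l ≤ j → sgn (j ∸ l) ≡ sgn j ℤ.* sgn l
sgn-∸ {j} {l} l≤j = begin
  sgn (j ∸ l)                          ≡⟨ ℤ.*-identityʳ (sgn (j ∸ l)) ⟨
  sgn (j ∸ l) ℤ.* + 1                  ≡⟨ cong (sgn (j ∸ l) ℤ.*_) (sgn*sgn≡1 l) ⟨
  sgn (j ∸ l) ℤ.* (sgn l ℤ.* sgn l)    ≡⟨ ℤ.*-assoc (sgn (j ∸ l)) (sgn l) (sgn l) ⟨
  sgn (j ∸ l) ℤ.* sgn l ℤ.* sgn l      ≡⟨ cong (ℤ._* sgn l) (sgn-+ (j ∸ l) l) ⟨
  sgn (j ∸ l + l) ℤ.* sgn l            ≡⟨ cong (λ i → sgn i ℤ.* sgn l) (ℕ.m∸n+n≡m l≤j) ⟩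
  sgn j ℤ.* sgn l                      ∎

sgn-odd : ∀ t → sgn (suc (2 * t)) ≡ -1ℤ
sgn-odd t = cong -_ (begin
  sgn (t + (t + 0))        ≡⟨ sgn-+ t (t + 0) ⟩
  sgn t ℤ.* sgn (t + 0)    ≡⟨ cong (λ i → sgn t ℤ.* sgn i) (ℕ.+-identityʳ t) ⟩
  sgn t ℤ.* sgn t          ≡⟨ sgn*sgn≡1 t ⟩
  + 1                      ∎)

[-x]^m≡sgn[m]*x^m : ∀ x m → (- x) ℤ.^ m ≡ sgn m ℤ.* x ℤ.^ m
[-x]^m≡sgn[m]*x^m x zero    = refl
[-x]^m≡sgn[m]*x^m x (suc m) =
  trans (cong (- x ℤ.*_) ([-x]^m≡sgn[m]*x^m x m)) (exchange x (sgn m) (x ℤ.^ m))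
  where
  exchange : ∀ a b c → (- a) ℤ.* (b ℤ.* c) ≡ (- b) ℤ.* (a ℤ.* c)
  exchange = solve-∀

binom⁻-≤ : ∀ a {r l} → l ≤ r → binom⁻ a r l ≡ + (a C (r ∸ l))
binom⁻-≤ a {r} {l} l≤r with l ≤ᵇ r | ℕ.≤⇒≤ᵇ l≤r
... | true | _ = refl

binom⁻-> : ∀ a {r l} → r < l → binom⁻ a r l ≡ + 0
binom⁻-> a {r} {l} r<l with l ≤ᵇ r in l≤ᵇr
... | false = refl
... | true  = ⊥-elim (ℕ.<⇒≱ r<l (ℕ.≤ᵇ⇒≤ l r (subst T (sym l≤ᵇr) tt)))

binom⁻-+ˡ : ∀ a l d → binom⁻ a (l + d) l ≡ + (a C d)
binom⁻-+ˡ a l d = trans (binom⁻-≤ a (ℕ.m≤m+n l d)) (cong (λ i → + (a C i)) (ℕ.m+n∸m≡n l d))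

[m+n]Cm≡[m+n]Cn : ∀ m n → (m + n) C m ≡ (m + n) C n
[m+n]Cm≡[m+n]Cn m n = trans (nCk≡nC[n∸k] (ℕ.m≤m+n m n)) (cong ((m + n) C_) (ℕ.m+n∸m≡n m n))

binom⁻-+ : ∀ a d r l → binom⁻ a (d + r) (d + l) ≡ binom⁻ a r l
binom⁻-+ a d r l with l ≤? r
... | yes l≤r = begin
  binom⁻ a (d + r) (d + l)       ≡⟨ binom⁻-≤ a (ℕ.+-monoʳ-≤ d l≤r) ⟩
  + (a C (d + r ∸ (d + l)))      ≡⟨ cong (λ i → + (a C i)) (ℕ.[m+n]∸[m+o]≡n∸o d r l) ⟩
  + (a C (r ∸ l))                ≡⟨ binom⁻-≤ a l≤r ⟨
  binom⁻ a r l                   ∎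
... | no l≰r = trans (binom⁻-> a (ℕ.+-monoʳ-< d r<l)) (sym (binom⁻-> a r<l))
  where r<l = ℕ.≰⇒> l≰r

binom⁻-sym : ∀ a r l → binom⁻ a r l ≡ binom⁻ a (a + l) r
binom⁻-sym a r l with l ≤? r
binom⁻-sym a r l | no l≰r = begin
  binom⁻ a r l                   ≡⟨ binom⁻-> a r<l ⟩
  + 0                            ≡⟨ cong +_ (k>n⇒nCk≡0 a<a+l∸r) ⟨
  + (a C (a + l ∸ r))            ≡⟨ binom⁻-≤ a (ℕ.≤-trans (ℕ.<⇒≤ r<l) (ℕ.m≤n+m l a)) ⟨
  binom⁻ a (a + l) r             ∎
  where
  r<l = ℕ.≰⇒> l≰r
  a<a+l∸r : a < a + l ∸ r
  a<a+l∸r = ℕ.m+n≤o⇒m≤o∸n (suc a) (ℕ.+-monoʳ-< a r<l)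
binom⁻-sym a r l | yes l≤r with ℕ.m≤n⇒∃[o]m+o≡n l≤r
... | d , refl with d ≤? a
...   | no d≰a = begin
  binom⁻ a (l + d) l             ≡⟨ binom⁻-+ˡ a l d ⟩
  + (a C d)                      ≡⟨ cong +_ (k>n⇒nCk≡0 a<d) ⟩
  + 0                            ≡⟨ binom⁻-> a a+l<l+d ⟨
  binom⁻ a (a + l) (l + d)       ∎
  where
  a<d = ℕ.≰⇒> d≰a
  a+l<l+d : a + l < l + d
  a+l<l+d = subst (_< l + d) (ℕ.+-comm l a) (ℕ.+-monoʳ-< l a<d)
...   | yes d≤a with ℕ.m≤n⇒∃[o]m+o≡n d≤a
...     | e , refl = begin
  binom⁻ (d + e) (l + d) l             ≡⟨ binom⁻-+ˡ (d + e) l d ⟩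
  + ((d + e) C d)                      ≡⟨ cong +_ ([m+n]Cm≡[m+n]Cn d e) ⟩
  + ((d + e) C e)                      ≡⟨ binom⁻-+ˡ (d + e) (l + d) e ⟨
  binom⁻ (d + e) (l + d + e) (l + d)   ≡⟨ cong (λ i → binom⁻ (d + e) i (l + d)) l+[d+e]≡[d+e]+l ⟩
  binom⁻ (d + e) (d + e + l) (l + d)   ∎
  where
  l+[d+e]≡[d+e]+l : l + d + e ≡ d + e + l
  l+[d+e]≡[d+e]+l = trans (ℕ.+-assoc l d e) (ℕ.+-comm l (d + e))

binom⁻-reflect : ∀ a j k l → l ≤ j → k ≤ a + j → binom⁻ a (a + j ∸ k) (j ∸ l) ≡ binom⁻ a k l
binom⁻-reflect a j k l l≤j k≤a+j with ℕ.m≤n⇒∃[o]m+o≡n l≤j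
... | p , refl = begin
  binom⁻ a (a + (l + p) ∸ k) (l + p ∸ l)       ≡⟨ cong (binom⁻ a (a + (l + p) ∸ k)) (ℕ.m+n∸m≡n l p) ⟩
  binom⁻ a (a + (l + p) ∸ k) p                 ≡⟨ binom⁻-+ a k _ p ⟨
  binom⁻ a (k + (a + (l + p) ∸ k)) (k + p)     ≡⟨ cong (λ i → binom⁻ a i (k + p)) (ℕ.m+[n∸m]≡n k≤a+j) ⟩
  binom⁻ a (a + (l + p)) (k + p)               ≡⟨ cong₂ (binom⁻ a) a+[l+p]≡p+[a+l] (ℕ.+-comm k p) ⟩
  binom⁻ a (p + (a + l)) (p + k)               ≡⟨ binom⁻-+ a p (a + l) k ⟩
  binom⁻ a (a + l) k                           ≡⟨ binom⁻-sym a k l ⟨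
  binom⁻ a k l                                 ∎
  where
  a+[l+p]≡p+[a+l] : a + (l + p) ≡ p + (a + l)
  a+[l+p]≡p+[a+l] = trans (sym (ℕ.+-assoc a l p)) (ℕ.+-comm (a + l) p)

-- K n r j with a = n − j and the sum stopped at l = j, beyond which C(j, l) = 0.
Kᵗ : ℕ → ℕ → ℕ → ℤ
Kᵗ a j r = sumℤ j (λ l → sgn l ℤ.* binom⁻ a r l ℤ.* + (j C l))

K≡Kᵗ : ∀ n r j → j ≤ n → K n r j ≡ Kᵗ (n ∸ j) j r
K≡Kᵗ n r j j≤n = sumℤ-truncate n j _ j≤n (λ l j<l → begin
  sgn l ℤ.* binom⁻ (n ∸ j) r l ℤ.* + (j C l)   ≡⟨ cong (λ c → sgn l ℤ.* binom⁻ (n ∸ j) r l ℤ.* + c) (k>n⇒nCk≡0 j<l) ⟩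
  sgn l ℤ.* binom⁻ (n ∸ j) r l ℤ.* + 0         ≡⟨ ℤ.*-zeroʳ (sgn l ℤ.* binom⁻ (n ∸ j) r l) ⟩
  + 0                                          ∎)

Kᵗ-reflect : ∀ a j k → k ≤ a + j → Kᵗ a j (a + j ∸ k) ≡ sgn j ℤ.* Kᵗ a j k
Kᵗ-reflect a j k k≤a+j = begin
  Kᵗ a j (a + j ∸ k)                                                      ≡⟨ sumℤ-reverse j _ ⟩
  sumℤ j (λ l → sgn (j ∸ l) ℤ.* binom⁻ a (a + j ∸ k) (j ∸ l) ℤ.* + (j C (j ∸ l)))
                                                                          ≡⟨ sumℤ-cong j reflect-term ⟩
  sumℤ j (λ l → sgn j ℤ.* (sgn l ℤ.* binom⁻ a k l ℤ.* + (j C l)))         ≡⟨ sumℤ-*ˡ j (sgn j) _ ⟩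
  sgn j ℤ.* Kᵗ a j k                                                      ∎
  where
  reassoc : ∀ s t b c → s ℤ.* t ℤ.* b ℤ.* c ≡ s ℤ.* (t ℤ.* b ℤ.* c)
  reassoc = solve-∀
  reflect-term : ∀ l → l ≤ j →
    sgn (j ∸ l) ℤ.* binom⁻ a (a + j ∸ k) (j ∸ l) ℤ.* + (j C (j ∸ l))
      ≡ sgn j ℤ.* (sgn l ℤ.* binom⁻ a k l ℤ.* + (j C l))
  reflect-term l l≤j = begin
    sgn (j ∸ l) ℤ.* binom⁻ a (a + j ∸ k) (j ∸ l) ℤ.* + (j C (j ∸ l))
      ≡⟨ cong₂ (λ b c → sgn (j ∸ l) ℤ.* b ℤ.* + c)
               (binom⁻-reflect a j k l l≤j k≤a+j) (sym (nCk≡nC[n∸k] l≤j)) ⟩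
    sgn (j ∸ l) ℤ.* binom⁻ a k l ℤ.* + (j C l)
      ≡⟨ cong (λ s → s ℤ.* binom⁻ a k l ℤ.* + (j C l)) (sgn-∸ l≤j) ⟩
    sgn j ℤ.* sgn l ℤ.* binom⁻ a k l ℤ.* + (j C l)
      ≡⟨ reassoc (sgn j) (sgn l) _ _ ⟩
    sgn j ℤ.* (sgn l ℤ.* binom⁻ a k l ℤ.* + (j C l)) ∎

K-reflect : ∀ n j k → j ≤ n → k ≤ n → K n (n ∸ k) j ≡ sgn j ℤ.* K n k j
K-reflect n j k j≤n k≤n = begin
  K n (n ∸ k) j         ≡⟨ K≡Kᵗ n (n ∸ k) j j≤n ⟩
  Kᵗ a j (n ∸ k)        ≡⟨ cong (λ i → Kᵗ a j (i ∸ k)) a+j≡n ⟨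
  Kᵗ a j (a + j ∸ k)    ≡⟨ Kᵗ-reflect a j k (subst (k ≤_) (sym a+j≡n) k≤n) ⟩
  sgn j ℤ.* Kᵗ a j k    ≡⟨ cong (sgn j ℤ.*_) (K≡Kᵗ n k j j≤n) ⟨
  sgn j ℤ.* K n k j     ∎
  where
  a = n ∸ j
  a+j≡n : a + j ≡ n
  a+j≡n = ℕ.m∸n+n≡m j≤n

n-2[n∸k]≡-[n-2k] : ∀ n k → k ≤ n → + n ℤ.- + (2 * (n ∸ k)) ≡ - (+ n ℤ.- + (2 * k))
n-2[n∸k]≡-[n-2k] n k k≤n with ℕ.m≤n⇒∃[o]m+o≡n k≤n
... | d , refl rewrite ℕ.m+n∸m≡n k d | ℤ.pos-+ k d | ℤ.pos-* 2 d | ℤ.pos-* 2 k = identity (+ k) (+ d)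
  where
  identity : ∀ x y → x ℤ.+ y ℤ.- + 2 ℤ.* y ≡ - (x ℤ.+ y ℤ.- + 2 ℤ.* x)
  identity = solve-∀

Ξ-numerator : ℕ → ℕ → ℕ → ℤ
Ξ-numerator n m j = sumℤ n (λ k → (+ n ℤ.- + (2 * k)) ℤ.^ m ℤ.* K n k j)

Ξ-numerator-odd : ∀ n m j → j ≤ n → ∃ (λ t → m + j ≡ suc (2 * t)) → Ξ-numerator n m j ≡ + 0
Ξ-numerator-odd n m j j≤n (t , m+j≡1+2t) = sumℤ-antisymmetric n summand summand-antisym
  where
  summand : ℕ → ℤ
  summand k = (+ n ℤ.- + (2 * k)) ℤ.^ m ℤ.* K n k j
  sgn[m]*sgn[j]≡-1 : sgn m ℤ.* sgn j ≡ -1ℤ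
  sgn[m]*sgn[j]≡-1 = trans (sym (sgn-+ m j)) (trans (cong sgn m+j≡1+2t) (sgn-odd t))
  regroup : ∀ s s′ y c → s ℤ.* y ℤ.* (s′ ℤ.* c) ≡ (s ℤ.* s′) ℤ.* (y ℤ.* c)
  regroup = solve-∀
  summand-antisym : ∀ k → k ≤ n → summand (n ∸ k) ≡ - summand k
  summand-antisym k k≤n = begin
    (+ n ℤ.- + (2 * (n ∸ k))) ℤ.^ m ℤ.* K n (n ∸ k) j
      ≡⟨ cong₂ ℤ._*_ (cong (ℤ._^ m) (n-2[n∸k]≡-[n-2k] n k k≤n)) (K-reflect n j k j≤n k≤n) ⟩
    (- w) ℤ.^ m ℤ.* (sgn j ℤ.* K n k j)
      ≡⟨ cong (ℤ._* (sgn j ℤ.* K n k j)) ([-x]^m≡sgn[m]*x^m w m) ⟩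
    sgn m ℤ.* w ℤ.^ m ℤ.* (sgn j ℤ.* K n k j)
      ≡⟨ regroup (sgn m) (sgn j) (w ℤ.^ m) (K n k j) ⟩
    (sgn m ℤ.* sgn j) ℤ.* summand k
      ≡⟨ cong (ℤ._* summand k) sgn[m]*sgn[j]≡-1 ⟩
    -1ℤ ℤ.* summand k
      ≡⟨ ℤ.-1*i≡-i (summand k) ⟩
    - summand k ∎
    where w = + n ℤ.- + (2 * k)

proposition6 : (n m j : ℕ) → 1 ≤ n → j ≤ n → ∃ (λ t → m + j ≡ suc (2 * t)) → Ξ n m j ≡ 0ℚ
proposition6 n m j _ j≤n m+j-odd = begin
  Ξ n m j                       ≡⟨⟩
  Ξ-numerator n m j ℚ./ 2 ^ n   ≡⟨ cong (ℚ._/ 2 ^ n) (Ξ-numerator-odd n m j j≤n m+j-odd) ⟩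
  + 0 ℚ./ 2 ^ n                 ≡⟨ ℚ.0/n≡0 (2 ^ n) ⟩
  0ℚ                            ∎
  where instance _ = ℕ.m^n≢0 2 n
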